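{- Let $a,b\geqslant2$ be coprime integers, $Q,A$ coprime integers, $\alpha=\frac AQ$, $M<Q$ a positive integer and $M_1=MQ$. Suppose that the set $\bigl(\Sigma_\alpha(M_1)-\Sigma_\alpha(M_1)\bigr)\cup\bigl(1-(\Sigma_\alpha(M_1)-\Sigma_\alpha(M_1))\bigr)$ is $\Delta$-dense in $[0,1]$, and let $n$ be a positive integer with $N=a^n\leqslant\frac1\Delta$. Let $$\mathfrak{X}_n^{M_1}=\Bigl\{x\in\mathbb{Z}:\ 0\leqslant x\leqslant a^n-1,\ \exists\,\eta\in\Sigma_\alpha(M_1)\ \text{with}\ \tfrac{x}{a^n}\leqslant\eta<\tfrac{x+1}{a^n}\Bigr\}.$$ Then the cardinality $X_n^{M_1}$ of $\mathfrak{X}_n^{M_1}$ satisfies $X_n^{M_1}\geqslant\frac{\sqrt N}{2}$.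
   Context: $\Sigma=\{a^ub^v:\ u,v \text{ nonnegative integers}\}$, $\Sigma(M)=\{q\in\Sigma:\ q\leqslant M\}$, $\Sigma_\alpha(M)=\{\{q\alpha\}:\ q\in\Sigma(M)\}$ with $\{\cdot\}$ the fractional part. For sets $E,F$, $E-F=\{e-f\}$ and $1-E=\{1-e\}$. A set is $\Delta$-dense in $[0,1]$ if every point of $[0,1]$ lies within distance $\Delta$ of some element of the set.
   Formalization: The density parameter Δ is rational, and the points of [0,1] at which Δ-density is tested are taken in ℚ. -}

module Defs where

open import Data.Nat as ℕ using (ℕ; suc; _^_; NonZero)
import Data.Nat.Properties as ℕP
open import Data.Integer as ℤ using (ℤ; +_)
open import Data.Rational using (ℚ; _/_; floor; _-_; _*_; _≤_; _<_; ∣_∣; 0ℚ; 1ℚ)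
open import Data.Product using (Σ; ∃; ∃-syntax; _×_)
open import Data.Sum using (_⊎_)
open import Data.List using (List; length)
open import Data.List.Relation.Unary.All using (All)
open import Data.List.Relation.Unary.Unique.Propositional using (Unique)
open import Relation.Binary.PropositionalEquality using (_≡_)

ℕ→ℚ : ℕ → ℚ
ℕ→ℚ n = (+ n) / 1

frac : ℚ → ℚ
frac p = p - ((floor p) / 1)

InΣ : ℕ → ℕ → ℕ → Set
InΣ a b q = ∃[ u ] ∃[ v ] (q ≡ a ^ u ℕ.* b ^ v)

InΣM : ℕ → ℕ → ℕ → ℕ → Set
InΣM a b M q = InΣ a b q × q ℕ.≤ M

InΣα : ℕ → ℕ → ℚ → ℕ → ℚ → Set
InΣα a b α M η = ∃[ q ] (InΣM a b M q × η ≡ frac (ℕ→ℚ q * α))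

Diff : (ℚ → Set) → (ℚ → Set) → ℚ → Set
Diff E F η = ∃[ e ] ∃[ f ] (E e × F f × η ≡ e - f)

OneMinus : (ℚ → Set) → ℚ → Set
OneMinus E η = ∃[ e ] (E e × η ≡ 1ℚ - e)

_∪_ : (ℚ → Set) → (ℚ → Set) → ℚ → Set
(E ∪ F) η = E η ⊎ F η

-- Δ-dense in [0,1] (points of [0,1] taken rational)
DenseIn01 : (ℚ → Set) → ℚ → Set
DenseIn01 E Δ = ∀ (x : ℚ) → 0ℚ ≤ x → x ≤ 1ℚ → ∃[ y ] (E y × ∣ x - y ∣ ≤ Δ)

InX : (a b : ℕ) → .{{_ : NonZero a}} → ℚ → ℕ → ℕ → ℤ → Set
InX a b α M n x =
  (+ 0) ℤ.≤ x × x ℤ.≤ (+ (a ^ n)) ℤ.- (+ 1) ×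
  ∃[ η ] (InΣα a b α M η ×
          (x / (a ^ n)) {{ℕP.m^n≢0 a n}} ≤ η ×
          η < ((x ℤ.+ (+ 1)) / (a ^ n)) {{ℕP.m^n≢0 a n}})

CardGE : {A : Set} → (A → Set) → ℕ → Set
CardGE {A} P k = ∃[ xs ] (Unique xs × All P xs × length {A = A} xs ≡ k)

nz2 : {a : ℕ} → 2 ℕ.≤ a → NonZero a
nz2 h = ℕ.>-nonZero (ℕP.≤-trans (ℕ.s≤s ℕ.z≤n) h)

nzlt : {m Q : ℕ} → m ℕ.< Q → NonZero Q
nzlt h = ℕ.>-nonZero (ℕP.≤-<-trans ℕ.z≤n h)

{-# OPTIONS --safe #-}
module Submission where

-- Put N = a^n and cut [0,1) into the N cells [x/N, (x+1)/N).  If e and f lie in cells x and y,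
-- then N(e - f) is at distance less than 1 from the integer x - y.  The density hypothesis puts
-- every j/N (0 ≤ j ≤ N) within 1/N of some e - f or 1 - (e - f), so j is within 1 of N(e - f)
-- or of N - N(e - f), hence |j - d| < 2 for d = x - y or d = N - (x - y).  Only X(X - 1)/2
-- differences x - y are positive, and a nonpositive one only reaches 0, 1, N - 1, N; so
-- N + 1 ≤ 4 + 3X(X - 1) for the number X of occupied cells, which gives N ≤ 4X².

open import Defs
open import Data.Nat as ℕ using (ℕ; _^_; _≤_; _<_; _*_)
open import Data.Nat.Coprimality using (Coprime)
open import Data.Integer as ℤ using (ℤ; ∣_∣)
open import Data.Rational as ℚ using (ℚ; _/_; 0ℚ; 1/_; >-nonZero)
open import Data.Product using (∃-syntax; _×_)

open import Data.Empty using (⊥-elim)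
open import Data.Integer using (+_; -[1+_]; +[1+_]; 0ℤ; 1ℤ)
import Data.Integer.DivMod as ℤ
import Data.Integer.Properties as ℤP
import Data.Integer.Tactic.RingSolver as ℤ-Ring
open import Data.List using (List; []; _∷_; _++_; length; map; upTo; deduplicate; filter; cartesianProduct)
open import Data.List.Membership.Propositional using (_∈_)
open import Data.List.Membership.Propositional.Properties
  using (∈-map⁺; ∈-map⁻; ∈-++⁺ˡ; ∈-++⁺ʳ; ∈-++⁻; ∈-∃++; ∈-deduplicate⁺; ∈-deduplicate⁻;
         ∈-upTo⁺; ∈-upTo⁻; ∈-length; ∈-filter⁺; ∈-filter⁻; ∈-cartesianProduct⁺)
open import Data.List.Properties using (length-++; length-map; length-upTo)
open import Data.List.Relation.Binary.Subset.Propositional using (_⊆_)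
open import Data.List.Relation.Unary.All as All using (All)
open import Data.List.Relation.Unary.AllPairs using (_∷_)
open import Data.List.Relation.Unary.Any using (here; there)
open import Data.List.Relation.Unary.Unique.Propositional using (Unique)
import Data.List.Relation.Unary.Unique.Propositional.Properties as Unique
import Data.List.Relation.Unary.Unique.DecPropositional.Properties as DecUnique
open import Data.Nat using (suc; zero; z≤n; s≤s; NonZero)
import Data.Nat.Properties as ℕP
import Data.Nat.Tactic.RingSolver as ℕ-Ring
open import Data.Product using (_,_; proj₁; proj₂)
open import Data.Rational using (mkℚ; 1ℚ; floor; *≤*; *<*)
open import Data.Rational.Literals using (fromℤ)
import Data.Rational.Properties as ℚP
import Data.Rational.Unnormalised as ℚᵘ
import Data.Rational.Unnormalised.Properties as ℚᵘP
open import Data.Sum using (_⊎_; inj₁; inj₂)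
open import Level using (0ℓ)
open import Relation.Binary.PropositionalEquality
open import Relation.Nullary using (yes; no)
open import Relation.Nullary.Decidable using (dec⇒maybe)
import Tactic.RingSolver as RingSolver
open import Tactic.RingSolver.Core.AlmostCommutativeRing using (AlmostCommutativeRing; fromCommutativeRing)

ℚ-ring : AlmostCommutativeRing 0ℓ 0ℓ
ℚ-ring = fromCommutativeRing ℚP.+-*-commutativeRing (λ p → dec⇒maybe (0ℚ ℚP.≟ p))

fromℤ≡z/1 : ∀ z → z / 1 ≡ fromℤ z
fromℤ≡z/1 z = ℚP.↥p/↧p≡p (fromℤ z)

fromℤ-mono-≤ : ∀ {i j} → i ℤ.≤ j → fromℤ i ℚ.≤ fromℤ j
fromℤ-mono-≤ {i} {j} i≤j = *≤* (subst₂ ℤ._≤_ (sym (ℤP.*-identityʳ i)) (sym (ℤP.*-identityʳ j)) i≤j)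

fromℤ-cancel-< : ∀ {i j} → fromℤ i ℚ.< fromℤ j → i ℤ.< j
fromℤ-cancel-< {i} {j} (*<* i<j) = subst₂ ℤ._<_ (ℤP.*-identityʳ i) (ℤP.*-identityʳ j) i<j

fromℤ-homo-+ : ∀ i j → fromℤ (i ℤ.+ j) ≡ fromℤ i ℚ.+ fromℤ j
fromℤ-homo-+ i j = ℚP.toℚᵘ-injective (ℚᵘP.≃-sym (ℚᵘP.≃-trans (ℚP.toℚᵘ-homo-+ (fromℤ i) (fromℤ j))
  (ℚᵘ.*≡* (cong₂ (λ x y → (x ℤ.+ y) ℤ.* 1ℤ) (ℤP.*-identityʳ i) (ℤP.*-identityʳ j)))))

fromℤ-homo‿- : ∀ i → fromℤ (ℤ.- i) ≡ ℚ.- fromℤ i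
fromℤ-homo‿- (+ zero) = refl
fromℤ-homo‿- +[1+ n ] = refl
fromℤ-homo‿- -[1+ n ] = refl

fromℤ-homo-minus : ∀ i j → fromℤ (i ℤ.- j) ≡ fromℤ i ℚ.- fromℤ j
fromℤ-homo-minus i j = trans (fromℤ-homo-+ i (ℤ.- j)) (cong (fromℤ i ℚ.+_) (fromℤ-homo‿- j))

instance
  fromℤ-positive : ∀ {n} .{{_ : NonZero n}} → ℚ.Positive (fromℤ (+ n))
  fromℤ-positive {suc _} = _

n*[z/n]≡z : ∀ z n .{{_ : NonZero n}} → fromℤ (+ n) ℚ.* (z / n) ≡ fromℤ z
n*[z/n]≡z z n@(suc k) = ℚP.toℚᵘ-injective (begin
  ℚ.toℚᵘ (fromℤ (+ n) ℚ.* (z / n))          ≈⟨ ℚP.toℚᵘ-homo-* (fromℤ (+ n)) (z / n) ⟩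
  ℚ.toℚᵘ (fromℤ (+ n)) ℚᵘ.* ℚ.toℚᵘ (z / n)  ≈⟨ ℚᵘP.*-congˡ {ℚ.toℚᵘ (fromℤ (+ n))} (ℚP.toℚᵘ-fromℚᵘ (ℚᵘ.mkℚᵘ z k)) ⟩
  ℚᵘ.mkℚᵘ (+ n) 0 ℚᵘ.* ℚᵘ.mkℚᵘ z k           ≈⟨ ℚᵘ.*≡* cross ⟩
  ℚᵘ.mkℚᵘ z 0                                 ∎)
  where
  open ℚᵘP.≃-Reasoning
  cross : (+ n ℤ.* z) ℤ.* 1ℤ ≡ z ℤ.* + suc (k ℕ.+ 0)
  cross = trans (ℤP.*-identityʳ _) (trans (ℤP.*-comm (+ n) z) (cong (λ m → z ℤ.* + suc m) (sym (ℕP.+-identityʳ k))))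

p*q-p*r≡p*[q-r] : ∀ p q r → p ℚ.* q ℚ.- p ℚ.* r ≡ p ℚ.* (q ℚ.- r)
p*q-p*r≡p*[q-r] = RingSolver.solve-∀ ℚ-ring

quotient-bounds : ∀ {n f D} r → n ≡ + r ℤ.+ f ℤ.* D → + r ℤ.< D →
                  f ℤ.* D ℤ.≤ n × n ℤ.< (f ℤ.+ 1ℤ) ℤ.* D
quotient-bounds {n} {f} {D} r n≡r+fD r<D = lower , upper
  where
  open ℤP.≤-Reasoning
  lower : f ℤ.* D ℤ.≤ n
  lower = begin
    f ℤ.* D          ≤⟨ ℤP.i≤j+i _ (+ r) ⟩
    + r ℤ.+ f ℤ.* D  ≡⟨ n≡r+fD ⟨
    n                ∎
  upper : n ℤ.< (f ℤ.+ 1ℤ) ℤ.* D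
  upper = begin-strict
    n                ≡⟨ n≡r+fD ⟩
    + r ℤ.+ f ℤ.* D  <⟨ ℤP.+-monoˡ-< (f ℤ.* D) r<D ⟩
    D ℤ.+ f ℤ.* D    ≡⟨ ℤ-Ring.solve (f ∷ D ∷ []) ⟩
    (f ℤ.+ 1ℤ) ℤ.* D ∎

floor-bounds : ∀ p → fromℤ (floor p) ℚ.≤ p × p ℚ.< fromℤ (floor p ℤ.+ 1ℤ)
floor-bounds p@(mkℚ n _ _) =
  *≤* (subst (f ℤ.* D ℤ.≤_) n≡n*1 (proj₁ bounds)) ,
  *<* (subst (ℤ._< (f ℤ.+ 1ℤ) ℤ.* D) n≡n*1 (proj₂ bounds))
  where
  f D : ℤ
  f = floor p
  D = ℚ.↧ p
  n≡n*1 : n ≡ n ℤ.* 1ℤ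
  n≡n*1 = sym (ℤP.*-identityʳ n)
  bounds : f ℤ.* D ℤ.≤ n × n ℤ.< (f ℤ.+ 1ℤ) ℤ.* D
  bounds = quotient-bounds {n} {f} {D} (n ℤ.% D) (ℤ.a≡a%n+[a/n]*n n D) (ℤ.+<+ (ℤ.n%d<d n D))

i<j⇒i≤j-1 : ∀ {i j} → i ℤ.< j → i ℤ.≤ j ℤ.- 1ℤ
i<j⇒i≤j-1 {i} {j} i<j = subst (i ℤ.≤_) (ℤP.+-comm ℤ.-1ℤ j) (ℤP.i<j⇒i≤pred[j] i<j)

i<j+1⇒i≤j : ∀ {i j} → i ℤ.< j ℤ.+ 1ℤ → i ℤ.≤ j
i<j+1⇒i≤j {i} {j} i<j+1 = subst (i ℤ.≤_) [j+1]-1≡j (i<j⇒i≤j-1 i<j+1)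
  where
  [j+1]-1≡j : j ℤ.+ 1ℤ ℤ.- 1ℤ ≡ j
  [j+1]-1≡j = ℤ-Ring.solve (j ∷ [])

0≤p⇒0≤⌊p⌋ : ∀ {p} → 0ℚ ℚ.≤ p → 0ℤ ℤ.≤ floor p
0≤p⇒0≤⌊p⌋ {p} 0≤p = i<j+1⇒i≤j (fromℤ-cancel-< (ℚP.≤-<-trans 0≤p (proj₂ (floor-bounds p))))

p<n⇒⌊p⌋<n : ∀ {p n} → p ℚ.< fromℤ n → floor p ℤ.< n
p<n⇒⌊p⌋<n {p} p<n = fromℤ-cancel-< (ℚP.≤-<-trans (proj₁ (floor-bounds p)) p<n)

0≤p-q<1 : ∀ {p q} → q ℚ.≤ p → p ℚ.< q ℚ.+ 1ℚ → 0ℚ ℚ.≤ p ℚ.- q × p ℚ.- q ℚ.< 1ℚ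
0≤p-q<1 {p} {q} q≤p p<q+1 =
  subst (ℚ._≤ p ℚ.- q) (ℚP.+-inverseʳ q) (ℚP.+-monoˡ-≤ (ℚ.- q) q≤p) ,
  subst (p ℚ.- q ℚ.<_) [q+1]-q≡1 (ℚP.+-monoˡ-< (ℚ.- q) p<q+1)
  where
  [q+1]-q≡1 : q ℚ.+ 1ℚ ℚ.- q ≡ 1ℚ
  [q+1]-q≡1 = RingSolver.solve (q ∷ []) ℚ-ring

frac≡p-⌊p⌋ : ∀ p → frac p ≡ p ℚ.- fromℤ (floor p)
frac≡p-⌊p⌋ p = cong (λ x → p ℚ.- x) (fromℤ≡z/1 (floor p))

frac-bounds : ∀ p → 0ℚ ℚ.≤ frac p × frac p ℚ.< 1ℚ
frac-bounds p rewrite frac≡p-⌊p⌋ p with floor-bounds p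
... | ⌊p⌋≤p , p<⌊p⌋+1 = 0≤p-q<1 ⌊p⌋≤p (subst (p ℚ.<_) (fromℤ-homo-+ (floor p) 1ℤ) p<⌊p⌋+1)

p-q<1 : ∀ {p q} → p ℚ.< 1ℚ → 0ℚ ℚ.≤ q → p ℚ.- q ℚ.< 1ℚ
p-q<1 p<1 0≤q = ℚP.+-mono-<-≤ p<1 (ℚP.neg-antimono-≤ 0≤q)

∣p-q∣<1 : ∀ {p q} → 0ℚ ℚ.≤ p → p ℚ.< 1ℚ → 0ℚ ℚ.≤ q → q ℚ.< 1ℚ → ℚ.∣ p ℚ.- q ∣ ℚ.< 1ℚ
∣p-q∣<1 {p} {q} 0≤p p<1 0≤q q<1 with ℚP.∣p∣≡p∨∣p∣≡-p (p ℚ.- q)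
... | inj₁ ∣p-q∣≡p-q    = subst (ℚ._< 1ℚ) (sym ∣p-q∣≡p-q) (p-q<1 p<1 0≤q)
... | inj₂ ∣p-q∣≡-[p-q] = subst (ℚ._< 1ℚ) (sym (trans ∣p-q∣≡-[p-q] -[p-q]≡q-p)) (p-q<1 q<1 0≤p)
  where
  -[p-q]≡q-p : ℚ.- (p ℚ.- q) ≡ q ℚ.- p
  -[p-q]≡q-p = RingSolver.solve (p ∷ q ∷ []) ℚ-ring

∣p-r∣≤∣p-q∣+∣q-r∣ : ∀ p q r → ℚ.∣ p ℚ.- r ∣ ℚ.≤ ℚ.∣ p ℚ.- q ∣ ℚ.+ ℚ.∣ q ℚ.- r ∣
∣p-r∣≤∣p-q∣+∣q-r∣ p q r =
  subst (λ x → ℚ.∣ x ∣ ℚ.≤ ℚ.∣ p ℚ.- q ∣ ℚ.+ ℚ.∣ q ℚ.- r ∣) [p-q]+[q-r]≡p-r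
        (ℚP.∣p+q∣≤∣p∣+∣q∣ (p ℚ.- q) (q ℚ.- r))
  where
  [p-q]+[q-r]≡p-r : (p ℚ.- q) ℚ.+ (q ℚ.- r) ≡ p ℚ.- r
  [p-q]+[q-r]≡p-r = RingSolver.solve (p ∷ q ∷ r ∷ []) ℚ-ring

∣[p-q]-[⌊p⌋-⌊q⌋]∣<1 : ∀ p q → ℚ.∣ (p ℚ.- q) ℚ.- fromℤ (floor p ℤ.- floor q) ∣ ℚ.< 1ℚ
∣[p-q]-[⌊p⌋-⌊q⌋]∣<1 p q = subst (λ x → ℚ.∣ x ∣ ℚ.< 1ℚ) (sym regroup)
  (∣p-q∣<1 (proj₁ (frac-bounds p)) (proj₂ (frac-bounds p)) (proj₁ (frac-bounds q)) (proj₂ (frac-bounds q)))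
  where
  open ≡-Reasoning
  interchange : ∀ a b c d → (a ℚ.- b) ℚ.- (c ℚ.- d) ≡ (a ℚ.- c) ℚ.- (b ℚ.- d)
  interchange = RingSolver.solve-∀ ℚ-ring
  regroup : (p ℚ.- q) ℚ.- fromℤ (floor p ℤ.- floor q) ≡ frac p ℚ.- frac q
  regroup = begin
    (p ℚ.- q) ℚ.- fromℤ (floor p ℤ.- floor q)           ≡⟨ cong (λ x → (p ℚ.- q) ℚ.- x) (fromℤ-homo-minus (floor p) (floor q)) ⟩
    (p ℚ.- q) ℚ.- (fromℤ (floor p) ℚ.- fromℤ (floor q))  ≡⟨ interchange p q (fromℤ (floor p)) (fromℤ (floor q)) ⟩
    (p ℚ.- fromℤ (floor p)) ℚ.- (q ℚ.- fromℤ (floor q))  ≡⟨ cong₂ ℚ._-_ (frac≡p-⌊p⌋ p) (frac≡p-⌊p⌋ q) ⟨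
    frac p ℚ.- frac q                                     ∎

∣[n-w]-[n-j]∣≡∣w-j∣ : ∀ n j w → ℚ.∣ (fromℤ n ℚ.- w) ℚ.- fromℤ (n ℤ.- j) ∣ ≡ ℚ.∣ w ℚ.- fromℤ j ∣
∣[n-w]-[n-j]∣≡∣w-j∣ n j w = begin
  ℚ.∣ (fromℤ n ℚ.- w) ℚ.- fromℤ (n ℤ.- j) ∣        ≡⟨ cong (λ x → ℚ.∣ (fromℤ n ℚ.- w) ℚ.- x ∣) (fromℤ-homo-minus n j) ⟩
  ℚ.∣ (fromℤ n ℚ.- w) ℚ.- (fromℤ n ℚ.- fromℤ j) ∣ ≡⟨ cong ℚ.∣_∣ (cancel (fromℤ n) (fromℤ j) w) ⟩
  ℚ.∣ ℚ.- (w ℚ.- fromℤ j) ∣                        ≡⟨ ℚP.∣-p∣≡∣p∣ (w ℚ.- fromℤ j) ⟩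
  ℚ.∣ w ℚ.- fromℤ j ∣                              ∎
  where
  open ≡-Reasoning
  cancel : ∀ a b c → (a ℚ.- c) ℚ.- (a ℚ.- b) ≡ ℚ.- (c ℚ.- b)
  cancel = RingSolver.solve-∀ ℚ-ring

z/n∈[0,1] : ∀ z n .{{_ : NonZero n}} → 0ℤ ℤ.≤ z → z ℤ.≤ + n → 0ℚ ℚ.≤ z / n × z / n ℚ.≤ 1ℚ
z/n∈[0,1] z n 0≤z z≤+n =
  ℚP.*-cancelˡ-≤-pos n̂ (subst₂ ℚ._≤_ (sym (ℚP.*-zeroʳ n̂)) (sym (n*[z/n]≡z z n)) (fromℤ-mono-≤ 0≤z)) ,
  ℚP.*-cancelˡ-≤-pos n̂ (subst₂ ℚ._≤_ (sym (n*[z/n]≡z z n)) (sym (ℚP.*-identityʳ n̂)) (fromℤ-mono-≤ z≤+n))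
  where
  n̂ : ℚ
  n̂ = fromℤ (+ n)

∣z/n-y∣≤Δ⇒∣z-ny∣≤1 : ∀ z n .{{_ : NonZero n}} y Δ → fromℤ (+ n) ℚ.* Δ ℚ.≤ 1ℚ →
                     ℚ.∣ z / n ℚ.- y ∣ ℚ.≤ Δ → ℚ.∣ fromℤ z ℚ.- fromℤ (+ n) ℚ.* y ∣ ℚ.≤ 1ℚ
∣z/n-y∣≤Δ⇒∣z-ny∣≤1 z n y Δ nΔ≤1 ∣z/n-y∣≤Δ = begin
  ℚ.∣ fromℤ z ℚ.- n̂ ℚ.* y ∣        ≡⟨ cong (λ x → ℚ.∣ x ℚ.- n̂ ℚ.* y ∣) (n*[z/n]≡z z n) ⟨
  ℚ.∣ n̂ ℚ.* (z / n) ℚ.- n̂ ℚ.* y ∣  ≡⟨ cong ℚ.∣_∣ (p*q-p*r≡p*[q-r] n̂ (z / n) y) ⟩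
  ℚ.∣ n̂ ℚ.* (z / n ℚ.- y) ∣        ≡⟨ ℚP.∣p*q∣≡∣p∣*∣q∣ n̂ (z / n ℚ.- y) ⟩
  ℚ.∣ n̂ ∣ ℚ.* ℚ.∣ z / n ℚ.- y ∣    ≡⟨ cong (ℚ._* ℚ.∣ z / n ℚ.- y ∣) (ℚP.0≤p⇒∣p∣≡p (ℚP.<⇒≤ (ℚP.positive⁻¹ n̂))) ⟩
  n̂ ℚ.* ℚ.∣ z / n ℚ.- y ∣          ≤⟨ ℚP.*-monoˡ-≤-nonNeg n̂ ∣z/n-y∣≤Δ ⟩
  n̂ ℚ.* Δ                          ≤⟨ nΔ≤1 ⟩
  1ℚ                                ∎
  where
  open ℚP.≤-Reasoning
  n̂ : ℚ
  n̂ = fromℤ (+ n)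

p≤1/q⇒p*q≤1 : ∀ {p q} (0<q : 0ℚ ℚ.< q) → p ℚ.≤ (1/ q) {{>-nonZero 0<q}} → p ℚ.* q ℚ.≤ 1ℚ
p≤1/q⇒p*q≤1 {p} {q} 0<q p≤1/q = ℚP.≤-trans (ℚP.*-monoʳ-≤-nonNeg q {{ℚ.nonNegative (ℚP.<⇒≤ 0<q)}} p≤1/q)
                                          (ℚP.≤-reflexive (ℚP.*-inverseˡ q {{>-nonZero 0<q}}))

around : ℤ → List ℤ
around j = j ℤ.- 1ℤ ∷ j ∷ j ℤ.+ 1ℤ ∷ []

j+k∈around-j : ∀ j k → ∣ k ∣ ℕ.< 2 → j ℤ.+ k ∈ around j
j+k∈around-j j (+ 0)           _ = there (here (ℤP.+-identityʳ j))
j+k∈around-j j (+ 1)           _ = there (there (here refl))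
j+k∈around-j j -[1+ 0 ]        _ = here refl
j+k∈around-j j (+ suc (suc _)) (s≤s (s≤s ()))
j+k∈around-j j -[1+ suc _ ]    (s≤s (s≤s ()))

∣i-j∣<2⇒i∈around-j : ∀ {i j} → ∣ i ℤ.- j ∣ ℕ.< 2 → i ∈ around j
∣i-j∣<2⇒i∈around-j {i} {j} ∣i-j∣<2 = subst (_∈ around j) j+[i-j]≡i (j+k∈around-j j (i ℤ.- j) ∣i-j∣<2)
  where
  j+[i-j]≡i : j ℤ.+ (i ℤ.- j) ≡ i
  j+[i-j]≡i = ℤ-Ring.solve (i ∷ j ∷ [])

∣i-w∣≤1⇒∣w-j∣<1⇒i∈around-j : ∀ {i j w} → ℚ.∣ fromℤ i ℚ.- w ∣ ℚ.≤ 1ℚ → ℚ.∣ w ℚ.- fromℤ j ∣ ℚ.< 1ℚ →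
                             i ∈ around j
∣i-w∣≤1⇒∣w-j∣<1⇒i∈around-j {i} {j} {w} ∣i-w∣≤1 ∣w-j∣<1 =
  ∣i-j∣<2⇒i∈around-j (ℤP.drop‿+<+ (fromℤ-cancel-< (begin-strict
    ℚ.∣ fromℤ (i ℤ.- j) ∣                        ≡⟨ cong ℚ.∣_∣ (fromℤ-homo-minus i j) ⟩
    ℚ.∣ fromℤ i ℚ.- fromℤ j ∣                    ≤⟨ ∣p-r∣≤∣p-q∣+∣q-r∣ (fromℤ i) w (fromℤ j) ⟩
    ℚ.∣ fromℤ i ℚ.- w ∣ ℚ.+ ℚ.∣ w ℚ.- fromℤ j ∣  <⟨ ℚP.+-mono-≤-< ∣i-w∣≤1 ∣w-j∣<1 ⟩
    fromℤ (+ 2)                                    ∎)))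
  where open ℚP.≤-Reasoning

∈-around⇒bounds : ∀ {i j} → i ∈ around j → j ℤ.- 1ℤ ℤ.≤ i × i ℤ.≤ j ℤ.+ 1ℤ
∈-around⇒bounds {j = j} (here refl)                 = ℤP.≤-refl , ℤP.≤-trans (ℤP.i-j≤i j 1ℤ) (ℤP.i≤i+j j 1ℤ)
∈-around⇒bounds {j = j} (there (here refl))         = ℤP.i-j≤i j 1ℤ , ℤP.i≤i+j j 1ℤ
∈-around⇒bounds {j = j} (there (there (here refl))) = ℤP.≤-trans (ℤP.i-j≤i j 1ℤ) (ℤP.i≤i+j j 1ℤ) , ℤP.≤-refl

i-1≤j≤i⇒j∈[i-1,i] : ∀ {i j} → i ℤ.- 1ℤ ℤ.≤ j → j ℤ.≤ i → j ∈ i ℤ.- 1ℤ ∷ i ∷ []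
i-1≤j≤i⇒j∈[i-1,i] {i} {j} i-1≤j j≤i with j ℤ.≟ i
... | yes j≡i = there (here j≡i)
... | no  j≢i = here (ℤP.≤-antisym (i<j⇒i≤j-1 (ℤP.≤∧≢⇒< j≤i j≢i)) i-1≤j)

around-nonpos : ∀ {d j} → d ℤ.≤ 0ℤ → 0ℤ ℤ.≤ j → j ∈ around d → j ∈ 0ℤ ∷ 1ℤ ∷ []
around-nonpos d≤0 0≤j j∈ =
  i-1≤j≤i⇒j∈[i-1,i] 0≤j (ℤP.≤-trans (proj₂ (∈-around⇒bounds j∈)) (ℤP.+-monoˡ-≤ 1ℤ d≤0))

around-n-nonpos : ∀ {n d j} → d ℤ.≤ 0ℤ → j ℤ.≤ n → j ∈ around (n ℤ.- d) → j ∈ n ℤ.- 1ℤ ∷ n ∷ []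
around-n-nonpos {n} {d} d≤0 j≤n j∈ =
  i-1≤j≤i⇒j∈[i-1,i] (ℤP.≤-trans n-1≤n-d-1 (proj₁ (∈-around⇒bounds j∈))) j≤n
  where
  n≤n-d : n ℤ.≤ n ℤ.- d
  n≤n-d = subst (ℤ._≤ n ℤ.- d) (ℤP.+-identityʳ n) (ℤP.+-monoʳ-≤ n (ℤP.neg-mono-≤ d≤0))
  n-1≤n-d-1 : n ℤ.- 1ℤ ℤ.≤ n ℤ.- d ℤ.- 1ℤ
  n-1≤n-d-1 = ℤP.+-monoˡ-≤ ℤ.-1ℤ n≤n-d

unique-⊆⇒length≤ : ∀ {A : Set} {xs ys : List A} → Unique xs → xs ⊆ ys → length xs ≤ length ys
unique-⊆⇒length≤ {xs = []}     _ _ = z≤n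
unique-⊆⇒length≤ {xs = x ∷ xs} (x∉xs ∷ unique-xs) x∷xs⊆ys with ∈-∃++ (x∷xs⊆ys (here refl))
... | us , vs , refl = begin
  suc (length xs)                 ≤⟨ s≤s (unique-⊆⇒length≤ unique-xs xs⊆us++vs) ⟩
  suc (length (us ++ vs))         ≡⟨ cong suc (length-++ us) ⟩
  suc (length us ℕ.+ length vs)   ≡⟨ ℕP.+-suc (length us) (length vs) ⟨
  length us ℕ.+ length (x ∷ vs)   ≡⟨ length-++ us ⟨
  length (us ++ x ∷ vs)           ∎
  where
  open ℕP.≤-Reasoning
  xs⊆us++vs : xs ⊆ us ++ vs
  xs⊆us++vs {z} z∈xs with ∈-++⁻ us (x∷xs⊆ys (there z∈xs))
  ... | inj₁ z∈us         = ∈-++⁺ˡ z∈us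
  ... | inj₂ (here z≡x)   = ⊥-elim (All.lookup x∉xs z∈xs (sym z≡x))
  ... | inj₂ (there z∈vs) = ∈-++⁺ʳ us z∈vs

distance : ℤ → ℤ → ℤ
distance x y = + ∣ x ℤ.- y ∣

distances : List ℤ → List ℤ
distances []       = []
distances (x ∷ xs) = map (distance x) xs ++ distances xs

length-distances : ∀ xs → 2 * length (distances xs) ℕ.+ length xs ≡ length xs * length xs
length-distances []       = refl
length-distances (x ∷ xs) = begin
  2 * length (map (distance x) xs ++ distances xs) ℕ.+ suc n  ≡⟨ cong (λ m → 2 * m ℕ.+ suc n) length-step ⟩
  2 * (n ℕ.+ d) ℕ.+ suc n                                     ≡⟨ expand n d ⟩
  (2 * d ℕ.+ n) ℕ.+ suc (2 * n)                               ≡⟨ cong (ℕ._+ suc (2 * n)) (length-distances xs) ⟩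
  n * n ℕ.+ suc (2 * n)                                       ≡⟨ square n ⟩
  suc n * suc n                                               ∎
  where
  open ≡-Reasoning
  n d : ℕ
  n = length xs
  d = length (distances xs)
  length-step : length (map (distance x) xs ++ distances xs) ≡ n ℕ.+ d
  length-step = trans (length-++ (map (distance x) xs)) (cong (ℕ._+ d) (length-map (distance x) xs))
  expand : ∀ n d → 2 * (n ℕ.+ d) ℕ.+ suc n ≡ (2 * d ℕ.+ n) ℕ.+ suc (2 * n)
  expand = ℕ-Ring.solve-∀
  square : ∀ n → n * n ℕ.+ suc (2 * n) ≡ suc n * suc n
  square = ℕ-Ring.solve-∀

∈-distances : ∀ {x y} xs → x ∈ xs → y ∈ xs → x ≢ y → distance x y ∈ distances xs
∈-distances (z ∷ zs) (here refl)  (here refl)  x≢y = ⊥-elim (x≢y refl)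
∈-distances (z ∷ zs) (here refl)  (there y∈zs) _   = ∈-++⁺ˡ (∈-map⁺ (distance z) y∈zs)
∈-distances {x} (z ∷ zs) (there x∈zs) (here refl) _ =
  ∈-++⁺ˡ (subst (λ m → + m ∈ map (distance z) zs) (ℤP.∣i-j∣≡∣j-i∣ z x) (∈-map⁺ (distance z) x∈zs))
∈-distances (z ∷ zs) (there x∈zs) (there y∈zs) x≢y = ∈-++⁺ʳ (map (distance z) zs) (∈-distances zs x∈zs y∈zs x≢y)

neighbourhoods : ℤ → List ℤ → List ℤ
neighbourhoods n []       = []
neighbourhoods n (d ∷ ds) = around d ++ around (n ℤ.- d) ++ neighbourhoods n ds

length-neighbourhoods : ∀ n ds → length (neighbourhoods n ds) ≡ 6 * length ds
length-neighbourhoods n []       = refl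
length-neighbourhoods n (d ∷ ds) = trans (cong (6 ℕ.+_) (length-neighbourhoods n ds)) (sym (ℕP.*-suc 6 (length ds)))

∈-neighbourhoods : ∀ {n d j} ds → d ∈ ds → j ∈ around d ⊎ j ∈ around (n ℤ.- d) → j ∈ neighbourhoods n ds
∈-neighbourhoods (d ∷ ds) (here refl) (inj₁ j∈) = ∈-++⁺ˡ j∈
∈-neighbourhoods (d ∷ ds) (here refl) (inj₂ j∈) = ∈-++⁺ʳ (around d) (∈-++⁺ˡ j∈)
∈-neighbourhoods {n} (e ∷ ds) (there d∈ds) j∈ =
  ∈-++⁺ʳ (around e) (∈-++⁺ʳ (around (n ℤ.- e)) (∈-neighbourhoods ds d∈ds j∈))

-- Within [0, n], a difference x - y ≤ 0 only reaches 0, 1, n - 1 and n; a positive one is the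
-- distance of two distinct entries of xs.
candidates : ℤ → List ℤ → List ℤ
candidates n xs = (0ℤ ∷ 1ℤ ∷ []) ++ (n ℤ.- 1ℤ ∷ n ∷ []) ++ neighbourhoods n (distances xs)

length-candidates : ∀ n xs → length (candidates n xs) ≡ 4 ℕ.+ 6 * length (distances xs)
length-candidates n xs = cong (4 ℕ.+_) (length-neighbourhoods n (distances xs))

∈-candidates : ∀ {n j x y} xs → x ∈ xs → y ∈ xs → 0ℤ ℤ.≤ j → j ℤ.≤ n →
               j ∈ around (x ℤ.- y) ⊎ j ∈ around (n ℤ.- (x ℤ.- y)) → j ∈ candidates n xs
∈-candidates {n} {j} {x} {y} xs x∈xs y∈xs 0≤j j≤n j∈ with x ℤ.- y ℤ.≤? 0ℤ | j∈
... | yes d≤0 | inj₁ j∈around = ∈-++⁺ˡ (around-nonpos d≤0 0≤j j∈around)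
... | yes d≤0 | inj₂ j∈around = ∈-++⁺ʳ (0ℤ ∷ 1ℤ ∷ []) (∈-++⁺ˡ (around-n-nonpos d≤0 j≤n j∈around))
... | no  d≰0 | _ = ∈-++⁺ʳ (0ℤ ∷ 1ℤ ∷ []) (∈-++⁺ʳ (n ℤ.- 1ℤ ∷ n ∷ [])
  (∈-neighbourhoods (distances xs) (subst (_∈ distances xs) distance≡d (∈-distances xs x∈xs y∈xs x≢y)) j∈))
  where
  distance≡d : distance x y ≡ x ℤ.- y
  distance≡d = ℤP.0≤i⇒+∣i∣≡i (ℤP.<⇒≤ (ℤP.≰⇒> d≰0))
  x≢y : x ≢ y
  x≢y x≡y = d≰0 (ℤP.≤-reflexive (ℤP.i≡j⇒i-j≡0 x≡y))

square-bound : ∀ N X P → suc N ≤ 4 ℕ.+ 6 * P → 2 * P ℕ.+ X ≡ X * X → 1 ≤ X → N ≤ 4 * (X * X)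
square-bound N X P N<4+6P 2P+X≡X² 1≤X =
  ℕP.≤-trans (ℕP.*-cancelˡ-≤ 2 (ℕP.+-cancelʳ-≤ 8 (2 * N) (2 * (3 * (X * X))) 2N+8≤6X²+8))
             (ℕP.*-monoˡ-≤ (X * X) (ℕP.n≤1+n 3))
  where
  open ℕP.≤-Reasoning
  2N+8≤6X²+8 : 2 * N ℕ.+ 8 ≤ 2 * (3 * (X * X)) ℕ.+ 8
  2N+8≤6X²+8 = begin
    2 * N ℕ.+ 8                  ≤⟨ ℕP.+-monoʳ-≤ (2 * N) (ℕP.+-monoʳ-≤ 2 (ℕP.*-monoʳ-≤ 6 1≤X)) ⟩
    2 * N ℕ.+ (2 ℕ.+ 6 * X)      ≡⟨ ℕ-Ring.solve (N ∷ X ∷ []) ⟩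
    2 * suc N ℕ.+ 6 * X          ≤⟨ ℕP.+-monoˡ-≤ (6 * X) (ℕP.*-monoʳ-≤ 2 N<4+6P) ⟩
    2 * (4 ℕ.+ 6 * P) ℕ.+ 6 * X  ≡⟨ ℕ-Ring.solve (P ∷ X ∷ []) ⟩
    6 * (2 * P ℕ.+ X) ℕ.+ 8      ≡⟨ cong (λ m → 6 * m ℕ.+ 8) 2P+X≡X² ⟩
    6 * (X * X) ℕ.+ 8            ≡⟨ ℕ-Ring.solve (X ∷ []) ⟩
    2 * (3 * (X * X)) ℕ.+ 8      ∎

-- Definitionally equal to InX when S = Σ_α(M₁) and N = a^n.
OccupiedCell : (ℚ → Set) → (N : ℕ) → .{{_ : NonZero N}} → ℤ → Set
OccupiedCell S N x =
  0ℤ ℤ.≤ x × x ℤ.≤ + N ℤ.- 1ℤ × ∃[ η ] (S η × x / N ℚ.≤ η × η ℚ.< (x ℤ.+ 1ℤ) / N)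

module _ (S : ℚ → Set) (ηs : List ℚ)
         (S⊆ηs : ∀ {η} → S η → η ∈ ηs) (ηs⊆S : ∀ {η} → η ∈ ηs → S η)
         (S-in-unit-interval : ∀ {η} → S η → 0ℚ ℚ.≤ η × η ℚ.< 1ℚ)
         (N : ℕ) .{{_ : NonZero N}} where

  private
    N̂ : ℚ
    N̂ = fromℤ (+ N)

  cell : ℚ → ℤ
  cell η = floor (N̂ ℚ.* η)

  cells : List ℤ
  cells = deduplicate ℤ._≟_ (map cell ηs)

  cell∈cells : ∀ {η} → S η → cell η ∈ cells
  cell∈cells Sη = ∈-deduplicate⁺ ℤ._≟_ (∈-map⁺ cell (S⊆ηs Sη))

  cell-occupied : ∀ {η} → S η → OccupiedCell S N (cell η)
  cell-occupied {η} Sη = 0≤p⇒0≤⌊p⌋ 0≤Nη , i<j⇒i≤j-1 (p<n⇒⌊p⌋<n Nη<N) , η , Sη , x/N≤η , η<[x+1]/N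
    where
    x : ℤ
    x = cell η
    Nη : ℚ
    Nη = N̂ ℚ.* η
    0≤Nη : 0ℚ ℚ.≤ Nη
    0≤Nη = subst (ℚ._≤ Nη) (ℚP.*-zeroʳ N̂) (ℚP.*-monoˡ-≤-nonNeg N̂ (proj₁ (S-in-unit-interval Sη)))
    Nη<N : Nη ℚ.< N̂
    Nη<N = subst (Nη ℚ.<_) (ℚP.*-identityʳ N̂) (ℚP.*-monoʳ-<-pos N̂ (proj₂ (S-in-unit-interval Sη)))
    x/N≤η : x / N ℚ.≤ η
    x/N≤η = ℚP.*-cancelˡ-≤-pos N̂ (subst (ℚ._≤ Nη) (sym (n*[z/n]≡z x N)) (proj₁ (floor-bounds Nη)))
    η<[x+1]/N : η ℚ.< (x ℤ.+ 1ℤ) / N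
    η<[x+1]/N = ℚP.*-cancelˡ-<-nonNeg N̂ (subst (Nη ℚ.<_) (sym (n*[z/n]≡z (x ℤ.+ 1ℤ) N)) (proj₂ (floor-bounds Nη)))

  cells-occupied : All (OccupiedCell S N) cells
  cells-occupied = All.tabulate λ x∈cells → occupied (∈-map⁻ cell (∈-deduplicate⁻ ℤ._≟_ (map cell ηs) x∈cells))
    where
    occupied : ∀ {x} → ∃[ η ] (η ∈ ηs × x ≡ cell η) → OccupiedCell S N x
    occupied (η , η∈ηs , refl) = cell-occupied (ηs⊆S η∈ηs)

  ∣N[e-f]-[⌊Ne⌋-⌊Nf⌋]∣<1 : ∀ e f → ℚ.∣ N̂ ℚ.* (e ℚ.- f) ℚ.- fromℤ (cell e ℤ.- cell f) ∣ ℚ.< 1ℚ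
  ∣N[e-f]-[⌊Ne⌋-⌊Nf⌋]∣<1 e f = subst (λ w → ℚ.∣ w ℚ.- fromℤ (cell e ℤ.- cell f) ∣ ℚ.< 1ℚ)
    (p*q-p*r≡p*[q-r] N̂ e f) (∣[p-q]-[⌊p⌋-⌊q⌋]∣<1 (N̂ ℚ.* e) (N̂ ℚ.* f))

  ∣N[1-[e-f]]-[N-[⌊Ne⌋-⌊Nf⌋]]∣<1 : ∀ e f →
    ℚ.∣ N̂ ℚ.* (1ℚ ℚ.- (e ℚ.- f)) ℚ.- fromℤ (+ N ℤ.- (cell e ℤ.- cell f)) ∣ ℚ.< 1ℚ
  ∣N[1-[e-f]]-[N-[⌊Ne⌋-⌊Nf⌋]]∣<1 e f = subst (ℚ._< 1ℚ) (sym (begin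
    ℚ.∣ N̂ ℚ.* (1ℚ ℚ.- (e ℚ.- f)) ℚ.- fromℤ (+ N ℤ.- d) ∣
      ≡⟨ cong (λ w → ℚ.∣ w ℚ.- fromℤ (+ N ℤ.- d) ∣) (distrib N̂ (e ℚ.- f)) ⟩
    ℚ.∣ (N̂ ℚ.- N̂ ℚ.* (e ℚ.- f)) ℚ.- fromℤ (+ N ℤ.- d) ∣
      ≡⟨ ∣[n-w]-[n-j]∣≡∣w-j∣ (+ N) d (N̂ ℚ.* (e ℚ.- f)) ⟩
    ℚ.∣ N̂ ℚ.* (e ℚ.- f) ℚ.- fromℤ d ∣
      ∎))
    (∣N[e-f]-[⌊Ne⌋-⌊Nf⌋]∣<1 e f)
    where
    open ≡-Reasoning
    d : ℤ
    d = cell e ℤ.- cell f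
    distrib : ∀ a b → a ℚ.* (1ℚ ℚ.- b) ≡ a ℚ.- a ℚ.* b
    distrib = RingSolver.solve-∀ ℚ-ring

  module _ (Δ : ℚ) (NΔ≤1 : N̂ ℚ.* Δ ℚ.≤ 1ℚ) (dense : DenseIn01 (Diff S S ∪ OneMinus (Diff S S)) Δ) where

    reachable : ∀ j → j ≤ N → + j ∈ candidates (+ N) cells
    reachable j j≤N = covered (dense (+ j / N) (proj₁ j/N∈[0,1]) (proj₂ j/N∈[0,1]))
      where
      0≤j : 0ℤ ℤ.≤ + j
      0≤j = ℤ.+≤+ z≤n
      j/N∈[0,1] : 0ℚ ℚ.≤ + j / N × + j / N ℚ.≤ 1ℚ
      j/N∈[0,1] = z/n∈[0,1] (+ j) N 0≤j (ℤ.+≤+ j≤N)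
      ∣j-Ny∣≤1 : ∀ {y} → ℚ.∣ + j / N ℚ.- y ∣ ℚ.≤ Δ → ℚ.∣ fromℤ (+ j) ℚ.- N̂ ℚ.* y ∣ ℚ.≤ 1ℚ
      ∣j-Ny∣≤1 {y} = ∣z/n-y∣≤Δ⇒∣z-ny∣≤1 (+ j) N y Δ NΔ≤1
      covered : ∃[ y ] ((Diff S S ∪ OneMinus (Diff S S)) y × ℚ.∣ + j / N ℚ.- y ∣ ℚ.≤ Δ) →
                + j ∈ candidates (+ N) cells
      covered (_ , inj₁ (e , f , Se , Sf , refl) , ∣j/N-y∣≤Δ) =
        ∈-candidates cells (cell∈cells Se) (cell∈cells Sf) 0≤j (ℤ.+≤+ j≤N)
          (inj₁ (∣i-w∣≤1⇒∣w-j∣<1⇒i∈around-j {w = N̂ ℚ.* (e ℚ.- f)}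
                   (∣j-Ny∣≤1 ∣j/N-y∣≤Δ) (∣N[e-f]-[⌊Ne⌋-⌊Nf⌋]∣<1 e f)))
      covered (_ , inj₂ (_ , (e , f , Se , Sf , refl) , refl) , ∣j/N-y∣≤Δ) =
        ∈-candidates cells (cell∈cells Se) (cell∈cells Sf) 0≤j (ℤ.+≤+ j≤N)
          (inj₂ (∣i-w∣≤1⇒∣w-j∣<1⇒i∈around-j {w = N̂ ℚ.* (1ℚ ℚ.- (e ℚ.- f))}
                   (∣j-Ny∣≤1 ∣j/N-y∣≤Δ) (∣N[1-[e-f]]-[N-[⌊Ne⌋-⌊Nf⌋]]∣<1 e f)))

    S-nonempty : ∃[ η ] S η
    S-nonempty with dense 0ℚ ℚP.≤-refl (ℚP.<⇒≤ (ℚP.positive⁻¹ 1ℚ))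
    ... | _ , inj₁ (e , _ , Se , _) , _         = e , Se
    ... | _ , inj₂ (_ , (e , _ , Se , _) , _) , _ = e , Se

    N+1≤|candidates| : suc N ≤ 4 ℕ.+ 6 * length (distances cells)
    N+1≤|candidates| = subst₂ _≤_ (trans (length-map +_ (upTo (suc N))) (length-upTo (suc N)))
                                   (length-candidates (+ N) cells)
      (unique-⊆⇒length≤ (Unique.map⁺ ℤP.+-injective (Unique.upTo⁺ (suc N))) 0…N⊆candidates)
      where
      0…N⊆candidates : map +_ (upTo (suc N)) ⊆ candidates (+ N) cells
      0…N⊆candidates z∈ with ∈-map⁻ +_ z∈
      ... | j , j∈ , refl = reachable j (ℕP.≤-pred (∈-upTo⁻ j∈))

    occupied-cells-bound : ∃[ X ] (CardGE (OccupiedCell S N) X × N ≤ 4 * (X * X))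
    occupied-cells-bound =
      length cells ,
      (cells , DecUnique.deduplicate-! ℤ._≟_ (map cell ηs) , cells-occupied , refl) ,
      square-bound N (length cells) (length (distances cells)) N+1≤|candidates| (length-distances cells)
        (∈-length (cell∈cells (proj₂ S-nonempty)))

n<m^n : ∀ {m} → 2 ≤ m → ∀ n → n < m ^ n
n<m^n 2≤m zero = s≤s z≤n
n<m^n {m} 2≤m (suc n) = begin-strict
  suc n            ≡⟨ ℕP.+-comm 1 n ⟩
  n ℕ.+ 1          <⟨ ℕP.+-mono-<-≤ (n<m^n 2≤m n) (ℕP.m^n>0 m {{nz2 2≤m}} n) ⟩
  m ^ n ℕ.+ m ^ n  ≡⟨ cong (m ^ n ℕ.+_) (ℕP.+-identityʳ (m ^ n)) ⟨
  2 * m ^ n        ≤⟨ ℕP.*-monoˡ-≤ (m ^ n) 2≤m ⟩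
  m * m ^ n        ∎
  where open ℕP.≤-Reasoning

power-product : ℕ → ℕ → ℕ × ℕ → ℕ
power-product a b (u , v) = a ^ u * b ^ v

exponentPairs : ℕ → List (ℕ × ℕ)
exponentPairs M = cartesianProduct (upTo (suc M)) (upTo (suc M))

enumerateΣ : ℕ → ℕ → ℕ → List ℕ
enumerateΣ a b M = filter (ℕ._≤? M) (map (power-product a b) (exponentPairs M))

∈-enumerateΣ⁻ : ∀ {a b M q} → q ∈ enumerateΣ a b M → InΣM a b M q
∈-enumerateΣ⁻ {a} {b} {M} q∈ with ∈-filter⁻ (ℕ._≤? M) {xs = map (power-product a b) (exponentPairs M)} q∈
... | q∈products , q≤M with ∈-map⁻ (power-product a b) {xs = exponentPairs M} q∈products
...   | (u , v) , _ , refl = (u , v , refl) , q≤M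

∈-enumerateΣ⁺ : ∀ {a b M q} → 2 ≤ a → 2 ≤ b → InΣM a b M q → q ∈ enumerateΣ a b M
∈-enumerateΣ⁺ {a} {b} {M} 2≤a 2≤b ((u , v , refl) , q≤M) =
  ∈-filter⁺ (ℕ._≤? M) (∈-map⁺ (power-product a b) (∈-cartesianProduct⁺ (∈-upTo⁺ (s≤s u≤M)) (∈-upTo⁺ (s≤s v≤M))))
    q≤M
  where
  open ℕP.≤-Reasoning
  u≤M : u ≤ M
  u≤M = begin
    u              ≤⟨ ℕP.<⇒≤ (n<m^n 2≤a u) ⟩
    a ^ u          ≤⟨ ℕP.m≤m*n (a ^ u) (b ^ v) {{ℕP.m^n≢0 b v {{nz2 2≤b}}}} ⟩
    a ^ u * b ^ v  ≤⟨ q≤M ⟩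
    M              ∎
  v≤M : v ≤ M
  v≤M = begin
    v              ≤⟨ ℕP.<⇒≤ (n<m^n 2≤b v) ⟩
    b ^ v          ≤⟨ ℕP.m≤n*m (b ^ v) (a ^ u) {{ℕP.m^n≢0 a u {{nz2 2≤a}}}} ⟩
    a ^ u * b ^ v  ≤⟨ q≤M ⟩
    M              ∎

fractional-multiple : ℚ → ℕ → ℚ
fractional-multiple α q = frac (ℕ→ℚ q ℚ.* α)

enumerateΣα : ℕ → ℕ → ℚ → ℕ → List ℚ
enumerateΣα a b α M = map (fractional-multiple α) (enumerateΣ a b M)

∈-enumerateΣα⁻ : ∀ {a b α M η} → η ∈ enumerateΣα a b α M → InΣα a b α M η
∈-enumerateΣα⁻ {α = α} η∈ with ∈-map⁻ (fractional-multiple α) η∈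
... | q , q∈ , refl = q , ∈-enumerateΣ⁻ q∈ , refl

∈-enumerateΣα⁺ : ∀ {a b α M η} → 2 ≤ a → 2 ≤ b → InΣα a b α M η → η ∈ enumerateΣα a b α M
∈-enumerateΣα⁺ {α = α} 2≤a 2≤b (q , q∈ΣM , refl) = ∈-map⁺ (fractional-multiple α) (∈-enumerateΣ⁺ 2≤a 2≤b q∈ΣM)

InΣα⇒0≤η<1 : ∀ {a b α M η} → InΣα a b α M η → 0ℚ ℚ.≤ η × η ℚ.< 1ℚ
InΣα⇒0≤η<1 {α = α} (q , _ , refl) = frac-bounds (ℕ→ℚ q ℚ.* α)

lemma2 : (a b : ℕ) (ha : 2 ≤ a) → 2 ≤ b → Coprime a b →
           (Q : ℕ) (A : ℤ) → Coprime ∣ A ∣ Q →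
           (M : ℕ) → 1 ≤ M → (hMQ : M < Q) →
           (Δ : ℚ) (hΔ : 0ℚ ℚ.< Δ) →
           DenseIn01
             (Diff (InΣα a b ((A / Q) {{nzlt hMQ}}) (M * Q)) (InΣα a b ((A / Q) {{nzlt hMQ}}) (M * Q))
              ∪ OneMinus (Diff (InΣα a b ((A / Q) {{nzlt hMQ}}) (M * Q)) (InΣα a b ((A / Q) {{nzlt hMQ}}) (M * Q))))
             Δ →
           (n : ℕ) → 1 ≤ n →
           ℕ→ℚ (a ^ n) ℚ.≤ (1/ Δ) {{>-nonZero hΔ}} →
           ∃[ X ] (CardGE (InX a b {{nz2 ha}} ((A / Q) {{nzlt hMQ}}) (M * Q) n) X × a ^ n ≤ 4 * (X * X))
lemma2 a b ha hb _ Q A _ M _ hMQ Δ hΔ dense n _ N≤1/Δ =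
  occupied-cells-bound (InΣα a b α (M * Q)) (enumerateΣα a b α (M * Q))
    (∈-enumerateΣα⁺ ha hb) ∈-enumerateΣα⁻ InΣα⇒0≤η<1 (a ^ n) {{ℕP.m^n≢0 a n {{nz2 ha}}}}
    Δ (p≤1/q⇒p*q≤1 hΔ (subst (ℚ._≤ _) (fromℤ≡z/1 (+ a ^ n)) N≤1/Δ)) dense
  where
  α : ℚ
  α = (A / Q) {{nzlt hMQ}}
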